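{- Let $\Gamma=(V,E)$ be a simple connected graph with adjacency matrix $A$ and set of distinct eigenvalues $\{\theta_0,\ldots,\theta_d\}$. Let $\pi=(V_1,\ldots,V_m)$ be a regular partition of $\Gamma$ with $V_1=\{u\}$ and quotient matrix $B$, whose set of distinct eigenvalues $\{\tau_0,\ldots,\tau_e\}$ is contained in $\{\theta_0,\ldots,\theta_d\}$. Suppose that for some $i$, $\theta_i$ is an eigenvalue of both $A$ and $B$ and $\theta_i$ has multiplicity $1$ as an eigenvalue of $B$. Let $\mathbf{u}_i=(u_{i1},\ldots,u_{im})$ and $\mathbf{v}_i=(v_{1i},\ldots,v_{mi})^{\top}$ be a left and a right eigenvector of $B$, respectively, for the eigenvalue $\theta_i$. Then for every vertex $v\in V_j$, $j=1,\ldots,m$, the crossed $uv$-local multiplicity of $\theta_i$ in $\Gamma$ is $$m_{uv}(\theta_i)=\frac{1}{|V_j|}\,\frac{v_{1i}\,u_{ij}}{\langle \mathbf{u}_i,\mathbf{v}_i\rangle}.$$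
   Context: A partition $\pi=(V_1,\ldots,V_m)$ of the vertex set is regular (equitable) if for all $i,j$ the number $b_{ij}$ of neighbours in $V_j$ of a vertex $w\in V_i$ does not depend on $w\in V_i$; $B=(b_{ij})$ is the quotient matrix. For an eigenvalue $\theta_i$ of $A$, let $E_i$ be the orthogonal projection (principal idempotent) onto the $\theta_i$-eigenspace of $A$; the crossed $uv$-local multiplicity is $m_{uv}(\theta_i)=(E_i)_{uv}$. Here $\langle \mathbf{u}_i,\mathbf{v}_i\rangle=\sum_k u_{ik}v_{ki}$. -}

module Defs where

open import Level using (Level; _⊔_) renaming (suc to lsuc)
open import Algebra.Bundles using (CommutativeRing)
open import Data.Nat as ℕ using (ℕ; zero; suc)
open import Data.Fin using (Fin; zero; suc; _≟_)
open import Data.Bool using (Bool; true; false; if_then_else_; _∧_)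
open import Data.Product using (Σ; ∃; _×_; _,_)
open import Data.Sum using (_⊎_)
open import Data.Vec using (Vec; []; _∷_)
open import Relation.Nullary using (¬_)
open import Relation.Nullary.Decidable using (⌊_⌋)
open import Relation.Binary.PropositionalEquality using (_≡_)

-- Monic polynomials: evalMonic (a₀ ∷ … ∷ a_{d-1} ∷ []) x
--   = x^d + a_{d-1} x^{d-1} + … + a₀   (Horner scheme)

module _ {c ℓ} (R : CommutativeRing c ℓ) where
  open CommutativeRing R
  evalMonic : ∀ {d} → Vec Carrier d → Carrier → Carrier
  evalMonic []       x = 1#
  evalMonic (a ∷ as) x = a + x * evalMonic as x

-- Real closed fields (the first-order theory of ℝ)

record RealClosedField c ℓ : Set (lsuc (c ⊔ ℓ)) where
  field
    commRing : CommutativeRing c ℓ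
  open CommutativeRing commRing public
  infix 4 _≤_
  field
    _≤_       : Carrier → Carrier → Set ℓ
    ≤-refl    : ∀ {x} → x ≤ x
    ≤-trans   : ∀ {x y z} → x ≤ y → y ≤ z → x ≤ z
    ≤-antisym : ∀ {x y} → x ≤ y → y ≤ x → x ≈ y
    ≤-total   : ∀ x y → (x ≤ y) ⊎ (y ≤ x)
    ≤-resp-≈  : ∀ {x x′ y y′} → x ≈ x′ → y ≈ y′ → x ≤ y → x′ ≤ y′
    +-mono-≤  : ∀ {x y} z → x ≤ y → x + z ≤ y + z
    *-nonneg  : ∀ {x y} → 0# ≤ x → 0# ≤ y → 0# ≤ x * y
    0≉1       : ¬ (0# ≈ 1#)
    inverse   : ∀ x → ¬ (x ≈ 0#) → ∃ λ y → x * y ≈ 1#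
    sqrt      : ∀ x → 0# ≤ x → ∃ λ y → y * y ≈ x
    oddRoot   : ∀ k (a : Vec Carrier (suc (2 ℕ.* k))) →
                ∃ λ x → evalMonic commRing a x ≈ 0#

record SimpleGraph (n : ℕ) : Set where
  field
    adj    : Fin n → Fin n → Bool
    sym    : ∀ x y → adj x y ≡ adj y x
    irrefl : ∀ x → adj x x ≡ false

module _ {n : ℕ} (Γ : SimpleGraph n) where
  open SimpleGraph Γ

  data Reach : Fin n → Fin n → Set where
    here : ∀ {x} → Reach x x
    step : ∀ {x y z} → adj x y ≡ true → Reach y z → Reach x z

  Connected : Set
  Connected = ∀ x y → Reach x y

count : ∀ {n} → (Fin n → Bool) → ℕ
count {zero}  P = 0
count {suc n} P = (if P zero then 1 else 0) ℕ.+ count (λ i → P (suc i))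

record RegularPartition {n : ℕ} (Γ : SimpleGraph n) (m : ℕ) : Set where
  open SimpleGraph Γ
  field
    cell     : Fin n → Fin m                 -- w ∈ V_{cell w}
    nonempty : ∀ j → ∃ λ w → cell w ≡ j
    b        : Fin m → Fin m → ℕ
    regular  : ∀ w j →
               count (λ x → adj w x ∧ ⌊ cell x ≟ j ⌋) ≡ b (cell w) j

  size : Fin m → ℕ
  size j = count (λ x → ⌊ cell x ≟ j ⌋)

module LinAlg {c ℓ} (F : RealClosedField c ℓ) where
  open RealClosedField F public using (Carrier; _≈_; _+_; _*_; 0#; 1#)

  Σ[_] : ∀ {n} → (Fin n → Carrier) → Carrier
  Σ[_] {zero}  f = 0#
  Σ[_] {suc n} f = f zero + Σ[ (λ i → f (suc i)) ]

  fromℕ : ℕ → Carrier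
  fromℕ zero    = 0#
  fromℕ (suc k) = 1# + fromℕ k

  Vector : ℕ → Set c
  Vector n = Fin n → Carrier

  Matrix : ℕ → ℕ → Set c
  Matrix m n = Fin m → Fin n → Carrier

  NonZero : ∀ {n} → Vector n → Set ℓ
  NonZero x = ∃ λ k → ¬ (x k ≈ 0#)

  _·ᵣ_ : ∀ {m n} → Matrix m n → Vector n → Vector m
  (M ·ᵣ x) i = Σ[ (λ k → M i k * x k) ]

  _·ₗ_ : ∀ {m n} → Vector m → Matrix m n → Vector n
  (x ·ₗ M) j = Σ[ (λ k → x k * M k j) ]

  _⊗_ : ∀ {l m n} → Matrix l m → Matrix m n → Matrix l n
  (M ⊗ N) i j = Σ[ (λ k → M i k * N k j) ]

  IsRightEigenvector : ∀ {n} → Matrix n n → Carrier → Vector n → Set ℓ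
  IsRightEigenvector M θ x = NonZero x × (∀ i → (M ·ᵣ x) i ≈ θ * x i)

  IsLeftEigenvector : ∀ {n} → Matrix n n → Carrier → Vector n → Set ℓ
  IsLeftEigenvector M θ x = NonZero x × (∀ j → (x ·ₗ M) j ≈ θ * x j)

  IsEigenvalue : ∀ {n} → Matrix n n → Carrier → Set (c ⊔ ℓ)
  IsEigenvalue M θ = ∃ λ x → IsRightEigenvector M θ x

  -- θ is an eigenvalue of M with multiplicity 1 (its eigenspace is a line)
  SimpleEigenvalue : ∀ {n} → Matrix n n → Carrier → Set (c ⊔ ℓ)
  SimpleEigenvalue M θ =
    ∃ λ x → IsRightEigenvector M θ x ×
      (∀ y → (∀ i → (M ·ᵣ y) i ≈ θ * y i) → ∃ λ s → ∀ i → y i ≈ s * x i)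

  -- E is the orthogonal projection onto the θ-eigenspace of M:
  -- E is symmetric and idempotent, its range lies in the eigenspace,
  -- and it fixes every vector of the eigenspace.
  IsEigenprojection : ∀ {n} → Matrix n n → Carrier → Matrix n n → Set (c ⊔ ℓ)
  IsEigenprojection M θ E =
    (∀ i j → E i j ≈ E j i) ×
    (∀ i j → (E ⊗ E) i j ≈ E i j) ×
    (∀ i j → (M ⊗ E) i j ≈ θ * E i j) ×
    (∀ z → (∀ i → (M ·ᵣ z) i ≈ θ * z i) → ∀ i → (E ·ᵣ z) i ≈ z i)

  adjMatrix : ∀ {n} → SimpleGraph n → Matrix n n
  adjMatrix Γ x y = if SimpleGraph.adj Γ x y then 1# else 0#

  quotMatrix : ∀ {n m} {Γ : SimpleGraph n} → RegularPartition Γ m → Matrix m m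
  quotMatrix π i j = fromℕ (RegularPartition.b π i j)

  ⟨_,_⟩ : ∀ {n} → Vector n → Vector n → Carrier
  ⟨ x , y ⟩ = Σ[ (λ k → x k * y k) ]

-- Let P be the averaging operator that replaces a vector by its mean on each cell. Regularity
-- (A Χᵀ = Χᵀ B for the cell-indicator matrix Χ) makes P map the θ-eigenspace of A into itself, so E fixes
-- P E e_u and P E e_x. As E and P are symmetric, so is E P E, and since {u} is a cell this yields
-- E u x = (P E e_u) x: the u-row of E is constant on cells and, as a vector on cells, a θ-eigenvector
-- of B, hence s v. Since D B is symmetric for D = diag |V_j|, left eigenvectors of B are D times
-- right ones, so u = t D v. Applying E to the lift of v gives s Σ_j |V_j| v_j² = v_1, while
-- ⟨u, v⟩ = t Σ_j |V_j| v_j², which is nonzero in an ordered field.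
module Submission where

open import Defs
open import Data.Nat using (zero; suc)
open import Data.Fin using (Fin; zero; suc; _≟_)
open import Data.Fin.Properties using (suc-injective)
open import Data.Bool using (Bool; true; false; if_then_else_; _∧_)
open import Data.Maybe using (nothing)
open import Data.Product using (∃; _×_; _,_; proj₁; proj₂; map₂)
open import Data.Sum using (inj₁; inj₂)
open import Function using (_∘_; flip)
open import Relation.Nullary using (¬_; Dec; yes; no; contradiction)
open import Relation.Nullary.Decidable using (⌊_⌋; isYes≗does; dec-true)
open import Relation.Binary.PropositionalEquality as ≡ using (_≡_; _≢_)

count-positive : ∀ {n} (P : Fin n → Bool) {w} → P w ≡ true → ∃ λ k → count P ≡ suc k
count-positive P {zero} Pw≡true rewrite Pw≡true = _ , ≡.refl
count-positive P {suc w} Pw≡true with count-positive (P ∘ suc) Pw≡true | P zero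
... | k , eq | true  = suc k , ≡.cong suc eq
... | k , eq | false = k , eq

module Summation {c ℓ} (F : RealClosedField c ℓ) where
  open RealClosedField F hiding (zero)
  open LinAlg F using (Σ[_]; fromℕ)
  open import Algebra.Properties.Semiring.Sum semiring
    using (sum; sum-cong-≋; sum-cong-≗; sum-replicate-zero; ∑-comm; *-distribˡ-sum; *-distribʳ-sum)
  open import Relation.Binary.Reasoning.Setoid setoid

  Σ≡sum : ∀ {n} (f : Fin n → Carrier) → Σ[ f ] ≡ sum f
  Σ≡sum {zero}  f = ≡.refl
  Σ≡sum {suc n} f = ≡.cong (f zero +_) (Σ≡sum (f ∘ suc))

  Σ-cong : ∀ {n} {f g : Fin n → Carrier} → (∀ i → f i ≈ g i) → Σ[ f ] ≈ Σ[ g ]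
  Σ-cong {f = f} {g} f≈g = begin
    Σ[ f ] ≡⟨ Σ≡sum f ⟩
    sum f  ≈⟨ sum-cong-≋ f≈g ⟩
    sum g  ≡⟨ Σ≡sum g ⟨
    Σ[ g ] ∎

  Σ-*ˡ : ∀ {n} a (f : Fin n → Carrier) → a * Σ[ f ] ≈ Σ[ (λ i → a * f i) ]
  Σ-*ˡ a f = begin
    a * Σ[ f ]             ≡⟨ ≡.cong (a *_) (Σ≡sum f) ⟩
    a * sum f              ≈⟨ *-distribˡ-sum a f ⟩
    sum (λ i → a * f i)    ≡⟨ Σ≡sum (λ i → a * f i) ⟨
    Σ[ (λ i → a * f i) ]   ∎

  Σ-*ʳ : ∀ {n} a (f : Fin n → Carrier) → Σ[ f ] * a ≈ Σ[ (λ i → f i * a) ]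
  Σ-*ʳ a f = begin
    Σ[ f ] * a             ≡⟨ ≡.cong (_* a) (Σ≡sum f) ⟩
    sum f * a              ≈⟨ *-distribʳ-sum a f ⟩
    sum (λ i → f i * a)    ≡⟨ Σ≡sum (λ i → f i * a) ⟨
    Σ[ (λ i → f i * a) ]   ∎

  Σ-swap : ∀ {m n} (f : Fin m → Fin n → Carrier) →
           Σ[ (λ i → Σ[ f i ]) ] ≈ Σ[ (λ j → Σ[ (λ i → f i j) ]) ]
  Σ-swap f = begin
    Σ[ (λ i → Σ[ f i ]) ]               ≡⟨ Σ²≡sum² f ⟩
    sum (λ i → sum (f i))               ≈⟨ ∑-comm f ⟩
    sum (λ j → sum (λ i → f i j))       ≡⟨ Σ²≡sum² (flip f) ⟨
    Σ[ (λ j → Σ[ (λ i → f i j) ]) ]     ∎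
    where
      Σ²≡sum² : ∀ {m n} (g : Fin m → Fin n → Carrier) →
                Σ[ (λ i → Σ[ g i ]) ] ≡ sum (λ i → sum (g i))
      Σ²≡sum² g = ≡.trans (Σ≡sum (λ i → Σ[ g i ])) (sum-cong-≗ (λ i → Σ≡sum (g i)))

  Σ-zero : ∀ {n} {f : Fin n → Carrier} → (∀ i → f i ≈ 0#) → Σ[ f ] ≈ 0#
  Σ-zero {n} f≈0 = trans (Σ-cong f≈0) (trans (reflexive (Σ≡sum {n} (λ _ → 0#))) (sum-replicate-zero n))

  Σ-concentrated : ∀ {n} (k : Fin n) (f : Fin n → Carrier) →
                   (∀ i → i ≢ k → f i ≈ 0#) → Σ[ f ] ≈ f k
  Σ-concentrated zero    f off = trans (+-congˡ (Σ-zero (λ i → off (suc i) λ ()))) (+-identityʳ _)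
  Σ-concentrated (suc k) f off = trans (+-cong (off zero λ ()) Σ-tail≈fk) (+-identityˡ _)
    where
      Σ-tail≈fk : Σ[ f ∘ suc ] ≈ f (suc k)
      Σ-tail≈fk = Σ-concentrated k (f ∘ suc) (λ i i≢k → off (suc i) (i≢k ∘ suc-injective))

  fromℕ-count : ∀ {n} (P : Fin n → Bool) → fromℕ (count P) ≈ Σ[ (λ x → if P x then 1# else 0#) ]
  fromℕ-count {zero}  P = refl
  fromℕ-count {suc n} P with P zero
  ... | true  = +-congˡ (fromℕ-count (P ∘ suc))
  ... | false = trans (fromℕ-count (P ∘ suc)) (sym (+-identityˡ _))

module Positivity {c ℓ} (F : RealClosedField c ℓ) where
  open RealClosedField F hiding (zero)
  open LinAlg F using (Σ[_]; fromℕ)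
  open import Algebra.Properties.Ring ring using (-‿distribˡ-*; -‿distribʳ-*; -‿involutive)
  open import Algebra.Properties.CommutativeSemigroup *-commutativeSemigroup using (xy∙z≈y∙xz)
  open import Relation.Binary.Reasoning.Setoid setoid

  +-nonneg : ∀ {x y} → 0# ≤ x → 0# ≤ y → 0# ≤ x + y
  +-nonneg {x} {y} 0≤x 0≤y = ≤-trans 0≤y (≤-resp-≈ (+-identityˡ y) refl (+-mono-≤ y 0≤x))

  +-nonneg-zeroˡ : ∀ {x y} → 0# ≤ x → 0# ≤ y → x + y ≈ 0# → x ≈ 0#
  +-nonneg-zeroˡ {x} {y} 0≤x 0≤y x+y≈0 = ≤-antisym x≤0 0≤x
    where
      x≤0 : x ≤ 0#
      x≤0 = ≤-resp-≈ (+-identityˡ x) (trans (+-comm y x) x+y≈0) (+-mono-≤ x 0≤y)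

  square-nonneg : ∀ x → 0# ≤ x * x
  square-nonneg x with ≤-total 0# x
  ... | inj₁ 0≤x = *-nonneg 0≤x 0≤x
  ... | inj₂ x≤0 = ≤-resp-≈ refl -x*-x≈x*x (*-nonneg 0≤-x 0≤-x)
    where
      0≤-x : 0# ≤ - x
      0≤-x = ≤-resp-≈ (-‿inverseʳ x) (+-identityˡ (- x)) (+-mono-≤ (- x) x≤0)
      -x*-x≈x*x : - x * - x ≈ x * x
      -x*-x≈x*x = begin
        - x * - x     ≈⟨ -‿distribˡ-* x (- x) ⟨
        - (x * - x)   ≈⟨ -‿cong (-‿distribʳ-* x x) ⟨
        - (- (x * x)) ≈⟨ -‿involutive (x * x) ⟩
        x * x         ∎

  *-nonzero : ∀ {a b} → ¬ (a ≈ 0#) → ¬ (b ≈ 0#) → ¬ (a * b ≈ 0#)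
  *-nonzero {a} {b} a≉0 b≉0 ab≈0 with inverse a a≉0
  ... | a⁻¹ , aa⁻¹≈1 = b≉0 (begin
    b              ≈⟨ *-identityˡ b ⟨
    1# * b         ≈⟨ *-congʳ aa⁻¹≈1 ⟨
    (a * a⁻¹) * b  ≈⟨ xy∙z≈y∙xz a a⁻¹ b ⟩
    a⁻¹ * (a * b)  ≈⟨ *-congˡ ab≈0 ⟩
    a⁻¹ * 0#       ≈⟨ zeroʳ a⁻¹ ⟩
    0#             ∎)

  Σ-squares-nonneg : ∀ {n} (f : Fin n → Carrier) → 0# ≤ Σ[ (λ x → f x * f x) ]
  Σ-squares-nonneg {zero}  f = ≤-refl
  Σ-squares-nonneg {suc n} f = +-nonneg (square-nonneg (f zero)) (Σ-squares-nonneg (f ∘ suc))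

  Σ-squares-nonzero : ∀ {n} (f : Fin n → Carrier) k → ¬ (f k ≈ 0#) → ¬ (Σ[ (λ x → f x * f x) ] ≈ 0#)
  Σ-squares-nonzero f zero fk≉0 Σ≈0 =
    *-nonzero fk≉0 fk≉0 (+-nonneg-zeroˡ (square-nonneg _) (Σ-squares-nonneg (f ∘ suc)) Σ≈0)
  Σ-squares-nonzero f (suc k) fk≉0 Σ≈0 =
    Σ-squares-nonzero (f ∘ suc) k fk≉0
      (+-nonneg-zeroˡ (Σ-squares-nonneg (f ∘ suc)) (square-nonneg _) (trans (+-comm _ _) Σ≈0))

  0≤1 : 0# ≤ 1#
  0≤1 = ≤-resp-≈ refl (*-identityˡ 1#) (square-nonneg 1#)

  fromℕ-nonneg : ∀ k → 0# ≤ fromℕ k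
  fromℕ-nonneg zero    = ≤-refl
  fromℕ-nonneg (suc k) = +-nonneg 0≤1 (fromℕ-nonneg k)

  fromℕ-suc-nonzero : ∀ k → ¬ (fromℕ (suc k) ≈ 0#)
  fromℕ-suc-nonzero k 1+k≈0 = 0≉1 (sym (+-nonneg-zeroˡ 0≤1 (fromℕ-nonneg k) 1+k≈0))

module Eigenvectors {c ℓ} (F : RealClosedField c ℓ) where
  open RealClosedField F hiding (zero)
  open LinAlg F hiding (Carrier; _≈_; _+_; _*_; 0#; 1#)
  open Summation F
  open import Algebra.Properties.CommutativeSemigroup *-commutativeSemigroup using (xy∙z≈y∙zx)
  open import Algebra.Solver.Ring.NaturalCoefficients commutativeSemiring (λ _ _ → nothing)
    using (solve; _:*_; _:=_)
  open import Relation.Binary.Reasoning.Setoid setoid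

  InEigenspace : ∀ {n} → Matrix n n → Carrier → Vector n → Set ℓ
  InEigenspace M θ x = ∀ i → (M ·ᵣ x) i ≈ θ * x i

  InLeftEigenspace : ∀ {n} → Matrix n n → Carrier → Vector n → Set ℓ
  InLeftEigenspace M θ x = ∀ j → (x ·ₗ M) j ≈ θ * x j

  IsSymmetric : ∀ {n} → Matrix n n → Set ℓ
  IsSymmetric M = ∀ i j → M i j ≈ M j i

  column : ∀ {m n} → Matrix m n → Fin n → Vector m
  column M j i = M i j

  ⟨⟩-cong : ∀ {n} {x x′ y y′ : Vector n} →
            (∀ k → x k ≈ x′ k) → (∀ k → y k ≈ y′ k) → ⟨ x , y ⟩ ≈ ⟨ x′ , y′ ⟩
  ⟨⟩-cong x≈x′ y≈y′ = Σ-cong (λ k → *-cong (x≈x′ k) (y≈y′ k))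

  ⟨⟩-comm : ∀ {n} (x y : Vector n) → ⟨ x , y ⟩ ≈ ⟨ y , x ⟩
  ⟨⟩-comm x y = Σ-cong (λ k → *-comm (x k) (y k))

  ·ᵣ-adjoint : ∀ {m n} (M : Matrix m n) x y → ⟨ M ·ᵣ x , y ⟩ ≈ ⟨ x , y ·ₗ M ⟩
  ·ᵣ-adjoint M x y = begin
    Σ[ (λ i → (M ·ᵣ x) i * y i) ]                  ≈⟨ Σ-cong (λ i → Σ-*ʳ (y i) (λ k → M i k * x k)) ⟩
    Σ[ (λ i → Σ[ (λ k → (M i k * x k) * y i) ]) ]  ≈⟨ Σ-swap (λ i k → (M i k * x k) * y i) ⟩
    Σ[ (λ k → Σ[ (λ i → (M i k * x k) * y i) ]) ]  ≈⟨ Σ-cong (λ k → Σ-cong (λ i → xy∙z≈y∙zx (M i k) (x k) (y i))) ⟩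
    Σ[ (λ k → Σ[ (λ i → x k * (y i * M i k)) ]) ]  ≈⟨ Σ-cong (λ k → Σ-*ˡ (x k) (λ i → y i * M i k)) ⟨
    ⟨ x , y ·ₗ M ⟩                                 ∎

  symmetric-⟨⟩ : ∀ {n} {M : Matrix n n} → IsSymmetric M → ∀ x y → ⟨ x , M ·ᵣ y ⟩ ≈ ⟨ y , M ·ᵣ x ⟩
  symmetric-⟨⟩ {M = M} M-sym x y = begin
    ⟨ x , M ·ᵣ y ⟩  ≈⟨ ⟨⟩-comm x (M ·ᵣ y) ⟩
    ⟨ M ·ᵣ y , x ⟩  ≈⟨ ·ᵣ-adjoint M y x ⟩
    ⟨ y , x ·ₗ M ⟩  ≈⟨ ⟨⟩-cong (λ _ → refl) x·M≈M·x ⟩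
    ⟨ y , M ·ᵣ x ⟩  ∎
    where
      x·M≈M·x : ∀ k → (x ·ₗ M) k ≈ (M ·ᵣ x) k
      x·M≈M·x k = Σ-cong (λ i → trans (*-comm (x i) (M i k)) (*-congʳ (M-sym i k)))

  sandwich-symmetric : ∀ {n} {E P : Matrix n n} →
                       IsSymmetric E → IsSymmetric P → IsSymmetric (E ⊗ (P ⊗ E))
  sandwich-symmetric {E = E} {P} E-sym P-sym x y = begin
    ⟨ E x , P ·ᵣ column E y ⟩           ≈⟨ ⟨⟩-cong (E-sym x) (λ _ → refl) ⟩
    ⟨ column E x , P ·ᵣ column E y ⟩    ≈⟨ symmetric-⟨⟩ P-sym (column E x) (column E y) ⟩
    ⟨ column E y , P ·ᵣ column E x ⟩    ≈⟨ ⟨⟩-cong (E-sym y) (λ _ → refl) ⟨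
    ⟨ E y , P ·ᵣ column E x ⟩           ∎

  simple⇒multiple : ∀ {n} {M : Matrix n n} {θ v} → SimpleEigenvalue M θ → IsRightEigenvector M θ v →
                    ∀ {y} → InEigenspace M θ y → ∃ λ s → ∀ i → y i ≈ s * v i
  simple⇒multiple {v = v} (x , _ , spanned) ((k , vk≉0) , v-eigen) {y} y-eigen
    with spanned v v-eigen | spanned y y-eigen
  ... | s₀ , v≈s₀x | s₁ , y≈s₁x = s₁ * s₀⁻¹ , λ i → begin
    y i                       ≈⟨ y≈s₁x i ⟩
    s₁ * x i                  ≈⟨ *-congˡ (*-identityˡ (x i)) ⟨
    s₁ * (1# * x i)           ≈⟨ *-congˡ (*-congʳ s₀s₀⁻¹≈1) ⟨
    s₁ * ((s₀ * s₀⁻¹) * x i)  ≈⟨ solve 4 (λ a b c d → a :* ((b :* c) :* d) := (a :* c) :* (b :* d))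
                                         refl s₁ s₀ s₀⁻¹ (x i) ⟩
    (s₁ * s₀⁻¹) * (s₀ * x i)  ≈⟨ *-congˡ (v≈s₀x i) ⟨
    (s₁ * s₀⁻¹) * v i         ∎
    where
      s₀≉0 : ¬ (s₀ ≈ 0#)
      s₀≉0 s₀≈0 = vk≉0 (trans (v≈s₀x k) (trans (*-congʳ s₀≈0) (zeroˡ (x k))))
      s₀⁻¹ : Carrier
      s₀⁻¹ = proj₁ (inverse s₀ s₀≉0)
      s₀s₀⁻¹≈1 : s₀ * s₀⁻¹ ≈ 1#
      s₀s₀⁻¹≈1 = proj₂ (inverse s₀ s₀≉0)

module EquitablePartition {c ℓ} (F : RealClosedField c ℓ) {n m}
                          (Γ : SimpleGraph n) (π : RegularPartition Γ m) where
  open RealClosedField F hiding (zero)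
  open LinAlg F hiding (Carrier; _≈_; _+_; _*_; 0#; 1#)
  open Summation F
  open Positivity F
  open Eigenvectors F
  open RegularPartition π
  open import Algebra.Properties.CommutativeSemigroup *-commutativeSemigroup
    using (x∙yz≈y∙xz; xy∙z≈x∙zy)
  open import Data.Maybe using (nothing)
  open import Algebra.Solver.Ring.NaturalCoefficients commutativeSemiring (λ _ _ → nothing)
    using (solve; _:*_; _:=_)
  open import Relation.Binary.Reasoning.Setoid setoid

  A : Matrix n n
  A = adjMatrix Γ

  B : Matrix m m
  B = quotMatrix π

  A-symmetric : IsSymmetric A
  A-symmetric x y = reflexive (≡.cong (λ b → if b then 1# else 0#) (SimpleGraph.sym Γ x y))

  indicator : Matrix m n
  indicator j x = if ⌊ cell x ≟ j ⌋ then 1# else 0#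

  indicator-∈ : ∀ {j x} → cell x ≡ j → indicator j x ≈ 1#
  indicator-∈ {j} {x} cell-x≡j with cell x ≟ j
  ... | yes _        = refl
  ... | no cell-x≢j  = contradiction cell-x≡j cell-x≢j

  indicator-∉ : ∀ {j x} → cell x ≢ j → indicator j x ≈ 0#
  indicator-∉ {j} {x} cell-x≢j with cell x ≟ j
  ... | yes cell-x≡j = contradiction cell-x≡j cell-x≢j
  ... | no _         = refl

  N : Vector m
  N j = fromℕ (size j)

  Σ-indicator : ∀ j → Σ[ indicator j ] ≈ N j
  Σ-indicator j = sym (fromℕ-count (λ x → ⌊ cell x ≟ j ⌋))

  N-nonzero : ∀ j → ¬ (N j ≈ 0#)
  N-nonzero j with nonempty j
  ... | w , cell-w≡j
      with count-positive (λ x → ⌊ cell x ≟ j ⌋)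
                          (≡.trans (isYes≗does (cell w ≟ j)) (dec-true (cell w ≟ j) cell-w≡j))
  ... | k , size≡1+k rewrite size≡1+k = fromℕ-suc-nonzero k

  N⁻¹ : Vector m
  N⁻¹ j = proj₁ (inverse (N j) (N-nonzero j))

  N*N⁻¹≈1 : ∀ j → N j * N⁻¹ j ≈ 1#
  N*N⁻¹≈1 j = proj₂ (inverse (N j) (N-nonzero j))

  ·ₗ-indicator : ∀ (g : Vector m) x → (g ·ₗ indicator) x ≈ g (cell x)
  ·ₗ-indicator g x = begin
    Σ[ (λ j → g j * indicator j x) ]  ≈⟨ Σ-concentrated (cell x) (λ j → g j * indicator j x) off ⟩
    g (cell x) * indicator (cell x) x ≈⟨ *-congˡ (indicator-∈ ≡.refl) ⟩
    g (cell x) * 1#                   ≈⟨ *-identityʳ (g (cell x)) ⟩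
    g (cell x)                        ∎
    where
      off : ∀ j → j ≢ cell x → g j * indicator j x ≈ 0#
      off j j≢cell-x = trans (*-congˡ (indicator-∉ (j≢cell-x ∘ ≡.sym))) (zeroʳ (g j))

  ⟨indicator,∘cell⟩ : ∀ j (g : Vector m) → ⟨ indicator j , g ∘ cell ⟩ ≈ N j * g j
  ⟨indicator,∘cell⟩ j g = begin
    ⟨ indicator j , g ∘ cell ⟩        ≈⟨ Σ-cong restrict ⟩
    Σ[ (λ x → indicator j x * g j) ]  ≈⟨ Σ-*ʳ (g j) (indicator j) ⟨
    Σ[ indicator j ] * g j            ≈⟨ *-congʳ (Σ-indicator j) ⟩
    N j * g j                         ∎
    where
      restrict : ∀ x → indicator j x * g (cell x) ≈ indicator j x * g j
      restrict x with cell x ≟ j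
      ... | yes cell-x≡j = *-congˡ (reflexive (≡.cong g cell-x≡j))
      ... | no _         = trans (zeroˡ _) (sym (zeroˡ _))

  Σ-∘cell : ∀ (g : Vector m) → Σ[ g ∘ cell ] ≈ Σ[ (λ j → N j * g j) ]
  Σ-∘cell g = begin
    Σ[ g ∘ cell ]                                  ≈⟨ Σ-cong (·ₗ-indicator g) ⟨
    Σ[ (λ x → Σ[ (λ j → g j * indicator j x) ]) ]  ≈⟨ Σ-swap (λ x j → g j * indicator j x) ⟩
    Σ[ (λ j → Σ[ (λ x → g j * indicator j x) ]) ]  ≈⟨ Σ-cong (λ j → Σ-*ˡ (g j) (indicator j)) ⟨
    Σ[ (λ j → g j * Σ[ indicator j ]) ]            ≈⟨ Σ-cong (λ j → trans (*-congˡ (Σ-indicator j)) (*-comm _ _)) ⟩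
    Σ[ (λ j → N j * g j) ]                         ∎

  A·indicator : ∀ w j → (A ·ᵣ indicator j) w ≈ B (cell w) j
  A·indicator w j = begin
    Σ[ (λ x → A w x * indicator j x) ]                         ≈⟨ Σ-cong (λ x → if-∧ (adj w x) _) ⟩
    Σ[ (λ x → if adj w x ∧ ⌊ cell x ≟ j ⌋ then 1# else 0#) ]  ≈⟨ fromℕ-count (λ x → adj w x ∧ ⌊ cell x ≟ j ⌋) ⟨
    fromℕ (count (λ x → adj w x ∧ ⌊ cell x ≟ j ⌋))            ≡⟨ ≡.cong fromℕ (regular w j) ⟩
    B (cell w) j                                               ∎
    where
      open SimpleGraph Γ using (adj)
      if-∧ : ∀ a b → (if a then 1# else 0#) * (if b then 1# else 0#) ≈ (if a ∧ b then 1# else 0#)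
      if-∧ true  b = *-identityˡ _
      if-∧ false b = zeroˡ _

  A·lift : ∀ (y : Vector m) w → (A ·ᵣ (y ∘ cell)) w ≈ (B ·ᵣ y) (cell w)
  A·lift y w = begin
    ⟨ A w , y ∘ cell ⟩           ≈⟨ ⟨⟩-cong (λ _ → refl) (·ₗ-indicator y) ⟨
    ⟨ A w , y ·ₗ indicator ⟩     ≈⟨ ·ᵣ-adjoint indicator (A w) y ⟨
    ⟨ indicator ·ᵣ A w , y ⟩     ≈⟨ ⟨⟩-cong indicator·Aw≈B (λ _ → refl) ⟩
    ⟨ B (cell w) , y ⟩           ∎
    where
      indicator·Aw≈B : ∀ j → (indicator ·ᵣ A w) j ≈ B (cell w) j
      indicator·Aw≈B j = trans (⟨⟩-comm (indicator j) (A w)) (A·indicator w j)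

  indicator·A : ∀ z j → ((indicator ·ᵣ z) ·ₗ B) j ≈ (indicator ·ᵣ (A ·ᵣ z)) j
  indicator·A z j = begin
    ⟨ indicator ·ᵣ z , column B j ⟩         ≈⟨ ·ᵣ-adjoint indicator z (column B j) ⟩
    ⟨ z , column B j ·ₗ indicator ⟩         ≈⟨ ⟨⟩-cong (λ _ → refl) B·indicator≈A·indicator ⟩
    ⟨ z , A ·ᵣ indicator j ⟩                ≈⟨ symmetric-⟨⟩ A-symmetric z (indicator j) ⟩
    ⟨ indicator j , A ·ᵣ z ⟩                ∎
    where
      B·indicator≈A·indicator : ∀ x → (column B j ·ₗ indicator) x ≈ (A ·ᵣ indicator j) x
      B·indicator≈A·indicator x = trans (·ₗ-indicator (column B j) x) (sym (A·indicator x j))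

  N-weighted-symmetric : ∀ i j → N i * B i j ≈ N j * B j i
  N-weighted-symmetric i j = begin
    N i * B i j                              ≈⟨ ⟨indicator,∘cell⟩ i (column B j) ⟨
    ⟨ indicator i , column B j ∘ cell ⟩      ≈⟨ ⟨⟩-cong (λ _ → refl) (λ x → A·indicator x j) ⟨
    ⟨ indicator i , A ·ᵣ indicator j ⟩       ≈⟨ symmetric-⟨⟩ A-symmetric (indicator i) (indicator j) ⟩
    ⟨ indicator j , A ·ᵣ indicator i ⟩       ≈⟨ ⟨⟩-cong (λ _ → refl) (λ x → A·indicator x i) ⟩
    ⟨ indicator j , column B i ∘ cell ⟩      ≈⟨ ⟨indicator,∘cell⟩ j (column B i) ⟩
    N j * B j i                              ∎

  B-N⁻¹-transpose : ∀ i j → B i j * N⁻¹ j ≈ N⁻¹ i * B j i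
  B-N⁻¹-transpose i j = begin
    B i j * N⁻¹ j                        ≈⟨ *-identityˡ _ ⟨
    1# * (B i j * N⁻¹ j)                 ≈⟨ *-congʳ (trans (*-comm (N⁻¹ i) (N i)) (N*N⁻¹≈1 i)) ⟨
    (N⁻¹ i * N i) * (B i j * N⁻¹ j)      ≈⟨ solve 4 (λ a b c d → (a :* b) :* (c :* d) := (a :* (b :* c)) :* d)
                                                     refl (N⁻¹ i) (N i) (B i j) (N⁻¹ j) ⟩
    (N⁻¹ i * (N i * B i j)) * N⁻¹ j      ≈⟨ *-congʳ (*-congˡ (N-weighted-symmetric i j)) ⟩
    (N⁻¹ i * (N j * B j i)) * N⁻¹ j      ≈⟨ solve 4 (λ a b c d → (a :* (b :* c)) :* d := (a :* c) :* (b :* d))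
                                                     refl (N⁻¹ i) (N j) (B j i) (N⁻¹ j) ⟩
    (N⁻¹ i * B j i) * (N j * N⁻¹ j)      ≈⟨ *-congˡ (N*N⁻¹≈1 j) ⟩
    (N⁻¹ i * B j i) * 1#                 ≈⟨ *-identityʳ _ ⟩
    N⁻¹ i * B j i                        ∎

  left⇒right : ∀ {θ X} → InLeftEigenspace B θ X → InEigenspace B θ (λ j → N⁻¹ j * X j)
  left⇒right {θ} {X} X-left i = begin
    Σ[ (λ j → B i j * (N⁻¹ j * X j)) ]  ≈⟨ Σ-cong transpose-term ⟩
    Σ[ (λ j → N⁻¹ i * (X j * B j i)) ]  ≈⟨ Σ-*ˡ (N⁻¹ i) (λ j → X j * B j i) ⟨
    N⁻¹ i * (X ·ₗ B) i                  ≈⟨ *-congˡ (X-left i) ⟩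
    N⁻¹ i * (θ * X i)                   ≈⟨ x∙yz≈y∙xz (N⁻¹ i) θ (X i) ⟩
    θ * (N⁻¹ i * X i)                   ∎
    where
      transpose-term : ∀ j → B i j * (N⁻¹ j * X j) ≈ N⁻¹ i * (X j * B j i)
      transpose-term j = begin
        B i j * (N⁻¹ j * X j)  ≈⟨ *-assoc (B i j) (N⁻¹ j) (X j) ⟨
        (B i j * N⁻¹ j) * X j  ≈⟨ *-congʳ (B-N⁻¹-transpose i j) ⟩
        (N⁻¹ i * B j i) * X j  ≈⟨ xy∙z≈x∙zy (N⁻¹ i) (B j i) (X j) ⟩
        N⁻¹ i * (X j * B j i)  ∎

  average : Vector n → Vector m
  average z j = N⁻¹ j * (indicator ·ᵣ z) j

  average-eigen : ∀ {θ z} → InEigenspace A θ z → InEigenspace B θ (average z)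
  average-eigen {θ} {z} z-eigen = left⇒right indicator·z-left
    where
      indicator·z-left : InLeftEigenspace B θ (indicator ·ᵣ z)
      indicator·z-left j = begin
        ((indicator ·ᵣ z) ·ₗ B) j                 ≈⟨ indicator·A z j ⟩
        Σ[ (λ x → indicator j x * (A ·ᵣ z) x) ]   ≈⟨ Σ-cong (λ x → trans (*-congˡ (z-eigen x)) (x∙yz≈y∙xz _ θ _)) ⟩
        Σ[ (λ x → θ * (indicator j x * z x)) ]    ≈⟨ Σ-*ˡ θ (λ x → indicator j x * z x) ⟨
        θ * (indicator ·ᵣ z) j                    ∎

  lift-eigen : ∀ {θ y} → InEigenspace B θ y → InEigenspace A θ (y ∘ cell)
  lift-eigen y-eigen w = trans (A·lift _ w) (y-eigen (cell w))

  averaging : Matrix n n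
  averaging x k = N⁻¹ (cell x) * indicator (cell x) k

  averaging-symmetric : IsSymmetric averaging
  averaging-symmetric x k = by-cases (cell k ≟ cell x)
    where
      by-cases : Dec (cell k ≡ cell x) → averaging x k ≈ averaging k x
      by-cases (yes cell-k≡cell-x) = begin
        N⁻¹ (cell x) * indicator (cell x) k  ≈⟨ *-congˡ (indicator-∈ cell-k≡cell-x) ⟩
        N⁻¹ (cell x) * 1#                    ≡⟨ ≡.cong (λ j → N⁻¹ j * 1#) cell-k≡cell-x ⟨
        N⁻¹ (cell k) * 1#                    ≈⟨ *-congˡ (indicator-∈ (≡.sym cell-k≡cell-x)) ⟨
        N⁻¹ (cell k) * indicator (cell k) x  ∎
      by-cases (no cell-k≢cell-x) = begin
        N⁻¹ (cell x) * indicator (cell x) k  ≈⟨ *-congˡ (indicator-∉ cell-k≢cell-x) ⟩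
        N⁻¹ (cell x) * 0#                    ≈⟨ zeroʳ _ ⟩
        0#                                   ≈⟨ zeroʳ _ ⟨
        N⁻¹ (cell k) * 0#                    ≈⟨ *-congˡ (indicator-∉ (cell-k≢cell-x ∘ ≡.sym)) ⟨
        N⁻¹ (cell k) * indicator (cell k) x  ∎

  averaging·ᵣ : ∀ z x → (averaging ·ᵣ z) x ≈ average z (cell x)
  averaging·ᵣ z x = begin
    Σ[ (λ k → (N⁻¹ (cell x) * indicator (cell x) k) * z k) ]  ≈⟨ Σ-cong (λ k → *-assoc _ _ (z k)) ⟩
    Σ[ (λ k → N⁻¹ (cell x) * (indicator (cell x) k * z k)) ]  ≈⟨ Σ-*ˡ (N⁻¹ (cell x)) (λ k → indicator (cell x) k * z k) ⟨
    average z (cell x)                                        ∎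

  averaging-eigen : ∀ {θ z} → InEigenspace A θ z → InEigenspace A θ (averaging ·ᵣ z)
  averaging-eigen {θ} {z} z-eigen w = begin
    (A ·ᵣ (averaging ·ᵣ z)) w        ≈⟨ Σ-cong (λ x → *-congˡ (averaging·ᵣ z x)) ⟩
    (A ·ᵣ (average z ∘ cell)) w      ≈⟨ lift-eigen (average-eigen z-eigen) w ⟩
    θ * average z (cell w)           ≈⟨ *-congˡ (averaging·ᵣ z w) ⟨
    θ * (averaging ·ᵣ z) w           ∎

  left-eigenvector-shape : ∀ {θ v w} → SimpleEigenvalue B θ → IsRightEigenvector B θ v →
                           IsLeftEigenvector B θ w →
                           ∃ λ t → ¬ (t ≈ 0#) × ∀ j → w j ≈ N j * (t * v j)
  left-eigenvector-shape {v = v} {w} simple v-right ((k , wk≉0) , w-left) = t , t≉0 , w≈Ntv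
    where
      N⁻¹w-multiple : ∃ λ t → ∀ j → N⁻¹ j * w j ≈ t * v j
      N⁻¹w-multiple = simple⇒multiple simple v-right (left⇒right w-left)
      t : Carrier
      t = proj₁ N⁻¹w-multiple
      N⁻¹w≈tv : ∀ j → N⁻¹ j * w j ≈ t * v j
      N⁻¹w≈tv = proj₂ N⁻¹w-multiple
      w≈Ntv : ∀ j → w j ≈ N j * (t * v j)
      w≈Ntv j = begin
        w j                  ≈⟨ *-identityˡ (w j) ⟨
        1# * w j             ≈⟨ *-congʳ (N*N⁻¹≈1 j) ⟨
        (N j * N⁻¹ j) * w j  ≈⟨ *-assoc (N j) (N⁻¹ j) (w j) ⟩
        N j * (N⁻¹ j * w j)  ≈⟨ *-congˡ (N⁻¹w≈tv j) ⟩
        N j * (t * v j)      ∎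
      t≉0 : ¬ (t ≈ 0#)
      t≉0 t≈0 = wk≉0 (begin
        w k              ≈⟨ w≈Ntv k ⟩
        N k * (t * v k)  ≈⟨ *-congˡ (*-congʳ t≈0) ⟩
        N k * (0# * v k) ≈⟨ *-congˡ (zeroˡ (v k)) ⟩
        N k * 0#         ≈⟨ zeroʳ (N k) ⟩
        0#               ∎)

  ⟨⟩-weighted : ∀ {t} {v w : Vector m} → (∀ j → w j ≈ N j * (t * v j)) →
                ⟨ w , v ⟩ ≈ t * ⟨ v ∘ cell , v ∘ cell ⟩
  ⟨⟩-weighted {t} {v} {w} w≈Ntv = begin
    ⟨ w , v ⟩                                  ≈⟨ Σ-cong (λ j → trans (*-congʳ (w≈Ntv j)) (regroup (N j) (v j))) ⟩
    Σ[ (λ j → t * (N j * (v j * v j))) ]       ≈⟨ Σ-*ˡ t (λ j → N j * (v j * v j)) ⟨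
    t * Σ[ (λ j → N j * (v j * v j)) ]         ≈⟨ *-congˡ (Σ-∘cell (λ j → v j * v j)) ⟨
    t * ⟨ v ∘ cell , v ∘ cell ⟩                ∎
    where
      regroup : ∀ a b → (a * (t * b)) * b ≈ t * (a * (b * b))
      regroup a b = solve 3 (λ a t b → (a :* (t :* b)) :* b := t :* (a :* (b :* b))) refl a t b

  lifted-nonzero : ∀ {v : Vector m} → NonZero v → ¬ (⟨ v ∘ cell , v ∘ cell ⟩ ≈ 0#)
  lifted-nonzero {v} (j , vj≉0) with nonempty j
  ... | w , cell-w≡j = Σ-squares-nonzero (v ∘ cell) w (λ v-cell-w≈0 → vj≉0 (trans (reflexive vj≡v-cell-w) v-cell-w≈0))
    where
      vj≡v-cell-w : v j ≡ v (cell w)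
      vj≡v-cell-w = ≡.cong v (≡.sym cell-w≡j)

  module SingletonCell (u : Fin n) (singleton : ∀ w → cell w ≡ cell u → w ≡ u) where

    indicator-singleton : ∀ x → x ≢ u → indicator (cell u) x ≈ 0#
    indicator-singleton x x≢u = indicator-∉ (x≢u ∘ singleton x)

    N⁻¹-singleton : N⁻¹ (cell u) ≈ 1#
    N⁻¹-singleton = begin
      N⁻¹ (cell u)                  ≈⟨ *-identityˡ _ ⟨
      1# * N⁻¹ (cell u)             ≈⟨ *-congʳ N-singleton ⟨
      N (cell u) * N⁻¹ (cell u)     ≈⟨ N*N⁻¹≈1 (cell u) ⟩
      1#                            ∎
      where
        N-singleton : N (cell u) ≈ 1#
        N-singleton = begin
          N (cell u)                ≈⟨ Σ-indicator (cell u) ⟨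
          Σ[ indicator (cell u) ]   ≈⟨ Σ-concentrated u (indicator (cell u)) indicator-singleton ⟩
          indicator (cell u) u      ≈⟨ indicator-∈ ≡.refl ⟩
          1#                        ∎

    average-singleton : ∀ z → average z (cell u) ≈ z u
    average-singleton z = begin
      N⁻¹ (cell u) * (indicator ·ᵣ z) (cell u)  ≈⟨ *-cong N⁻¹-singleton (Σ-concentrated u _ off) ⟩
      1# * (indicator (cell u) u * z u)         ≈⟨ *-identityˡ _ ⟩
      indicator (cell u) u * z u                ≈⟨ *-congʳ (indicator-∈ ≡.refl) ⟩
      1# * z u                                  ≈⟨ *-identityˡ (z u) ⟩
      z u                                       ∎
      where
        off : ∀ x → x ≢ u → indicator (cell u) x * z x ≈ 0#
        off x x≢u = trans (*-congʳ (indicator-singleton x x≢u)) (zeroˡ (z x))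

    eigenprojection-row : ∀ {θ E} → IsEigenprojection A θ E →
                          ∀ x → E u x ≈ average (column E u) (cell x)
    eigenprojection-row {E = E} (E-sym , _ , AE≈θE , E-fixes) x = sym (begin
      average (column E u) (cell x)   ≈⟨ averaging·ᵣ (column E u) x ⟨
      (averaging ·ᵣ column E u) x     ≈⟨ E-fixes _ (averaging-eigen (λ i → AE≈θE i u)) x ⟨
      (E ⊗ (averaging ⊗ E)) x u       ≈⟨ sandwich-symmetric E-sym averaging-symmetric x u ⟩
      (E ⊗ (averaging ⊗ E)) u x       ≈⟨ E-fixes _ (averaging-eigen (λ i → AE≈θE i x)) u ⟩
      (averaging ·ᵣ column E x) u     ≈⟨ averaging·ᵣ (column E x) u ⟩
      average (column E x) (cell u)   ≈⟨ average-singleton (column E x) ⟩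
      E u x                           ∎)

    eigenprojection-row-∝ : ∀ {θ E v} → SimpleEigenvalue B θ → IsRightEigenvector B θ v →
                            IsEigenprojection A θ E → ∃ λ s → ∀ x → E u x ≈ s * v (cell x)
    eigenprojection-row-∝ simple v-right E-proj@(_ , _ , AE≈θE , _) =
      map₂ (λ average≈sv x → trans (eigenprojection-row E-proj x) (average≈sv (cell x)))
           (simple⇒multiple simple v-right (average-eigen (λ i → AE≈θE i u)))

    eigenprojection-row-weight : ∀ {θ E v s} → IsEigenprojection A θ E → InEigenspace B θ v →
                                 (∀ x → E u x ≈ s * v (cell x)) →
                                 s * ⟨ v ∘ cell , v ∘ cell ⟩ ≈ v (cell u)
    eigenprojection-row-weight {E = E} {v} {s} (_ , _ , _ , E-fixes) v-eigen Eu≈sv = begin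
      s * ⟨ v ∘ cell , v ∘ cell ⟩                  ≈⟨ Σ-*ˡ s (λ x → v (cell x) * v (cell x)) ⟩
      Σ[ (λ x → s * (v (cell x) * v (cell x))) ]   ≈⟨ Σ-cong (λ x → trans (sym (*-assoc s _ _)) (*-congʳ (sym (Eu≈sv x)))) ⟩
      (E ·ᵣ (v ∘ cell)) u                          ≈⟨ E-fixes (v ∘ cell) (lift-eigen v-eigen) u ⟩
      v (cell u)                                   ∎

    crossed-local-multiplicity :
      ∀ {θ E uL vR} → SimpleEigenvalue B θ → IsLeftEigenvector B θ uL → IsRightEigenvector B θ vR →
      IsEigenprojection A θ E → ∀ v →
        ¬ (⟨ uL , vR ⟩ ≈ 0#) × (E u v * (N (cell v) * ⟨ uL , vR ⟩) ≈ vR (cell u) * uL (cell v))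
    crossed-local-multiplicity {E = E} {uL} {vR} simple uL-left vR-right@(vR≢0 , vR-eigen) E-proj v =
      let s , Eu≈svR        = eigenprojection-row-∝ simple vR-right E-proj
          t , t≉0 , uL≈NtvR = left-eigenvector-shape simple vR-right uL-left
          Q                 = ⟨ vR ∘ cell , vR ∘ cell ⟩
          ⟨uL,vR⟩≈tQ        = ⟨⟩-weighted uL≈NtvR
          j                 = cell v
      in  (λ ⟨uL,vR⟩≈0 → *-nonzero t≉0 (lifted-nonzero vR≢0) (trans (sym ⟨uL,vR⟩≈tQ) ⟨uL,vR⟩≈0))
        , (begin
          E u v * (N j * ⟨ uL , vR ⟩)    ≈⟨ *-cong (Eu≈svR v) (*-congˡ ⟨uL,vR⟩≈tQ) ⟩
          (s * vR j) * (N j * (t * Q))   ≈⟨ solve 5 (λ s x n t q → (s :* x) :* (n :* (t :* q)) := (s :* q) :* (n :* (t :* x)))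
                                                    refl s (vR j) (N j) t Q ⟩
          (s * Q) * (N j * (t * vR j))   ≈⟨ *-cong (eigenprojection-row-weight E-proj vR-eigen Eu≈svR) (sym (uL≈NtvR j)) ⟩
          vR (cell u) * uL j             ∎)

mainTheorem3 :
    ∀ {c ℓ} (F : RealClosedField c ℓ) →
    let open LinAlg F in
    ∀ {n m} (Γ : SimpleGraph n) → Connected Γ →
    (π : RegularPartition Γ (suc m)) →
    (u : Fin n) →
    RegularPartition.cell π u ≡ zero →
    (∀ w → RegularPartition.cell π w ≡ zero → w ≡ u) →
    (∀ τ → IsEigenvalue (quotMatrix π) τ → IsEigenvalue (adjMatrix Γ) τ) →
    (θ : Carrier) →
    IsEigenvalue (adjMatrix Γ) θ →
    SimpleEigenvalue (quotMatrix π) θ →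
    (uL vR : Vector (suc m)) →
    IsLeftEigenvector (quotMatrix π) θ uL →
    IsRightEigenvector (quotMatrix π) θ vR →
    (E : Matrix n n) → IsEigenprojection (adjMatrix Γ) θ E →
    ∀ v →
      ¬ (⟨ uL , vR ⟩ ≈ 0#) ×
      (E u v * (fromℕ (RegularPartition.size π (RegularPartition.cell π v)) * ⟨ uL , vR ⟩)
        ≈ vR zero * uL (RegularPartition.cell π v))
mainTheorem3 F Γ _ π u cell-u≡0 only-u _ _ _ simple uL vR uL-left vR-right E E-proj v =
  map₂ (λ multiplicity → trans multiplicity (*-congʳ (reflexive (≡.cong vR cell-u≡0))))
       (crossed-local-multiplicity simple uL-left vR-right E-proj v)
  where
    open RealClosedField F using (trans; *-congʳ; reflexive)
    open EquitablePartition F Γ π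
    open SingletonCell u (λ w cell-w≡cell-u → only-u w (≡.trans cell-w≡cell-u cell-u≡0))
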